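{- Fix $n\ge1$ and an integer $0\le\alpha<2^n$ whose $n$-bit binary representation (most significant bit first, leading zeros allowed) is $\sigma=\sigma_1\cdots\sigma_m$, where the $\sigma_i$ are the maximal runs of equal bits, $\sigma_i$ of length $L_i$. Let $S$ be uniform on $\{0,\dots,2^n-1\}$, $T=S+\alpha\bmod 2^n$, write $S=S_1\cdots S_m$, $T=T_1\cdots T_m$ with $|S_i|=|T_i|=L_i$, and let $X_i=wt(S_i)$, $Y_i=wt(T_i)$, with carries $c_i$ as defined in the context. Suppose $\sigma_i=1^{L_i}$. Then, whenever the conditioning event has positive probability, the joint probability mass function of $(X_i,Y_i)$ is: $p_i(x,y\mid c_{i+1}=1,c_i=1)=\frac{1}{2^{L_i}}\binom{L_i}{x}$ if $x=y$, and $0$ otherwise; $p_i(x,y\mid c_{i+1}=0,c_i=0)=1$ if $(x,y)=(0,L_i)$, and $0$ otherwise; $p_i(x,y\mid c_{i+1}=0,c_i=1)=\frac{1}{2^{L_i}-1}\binom{L_i-y+x-2}{x-1}$ if $L_i-1\ge y\ge x-1\ge0$, and $0$ otherwise.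
   Context: $wt$ denotes Hamming weight. Addition $S+\alpha$ is performed block by block starting from the least significant block $m$: set $c_{m+1}=0$; for each $i$, viewing $S_i$ and $\sigma_i$ as integers in $[0,2^{L_i})$, $T_i\equiv S_i+\sigma_i+c_{i+1}\pmod{2^{L_i}}$, and $c_i=1$ if $S_i+\sigma_i+c_{i+1}\ge 2^{L_i}$, $c_i=0$ otherwise ($c_i$ is the carry passed from block $i$ to block $i-1$). -}

module Defs where

open import Data.Nat using (ℕ; zero; suc; _+_; _*_; _∸_; _^_; _≤_; _<_; _≤ᵇ_; _≡ᵇ_)
open import Data.Nat.DivMod using (_/_; _%_)
open import Data.Nat.Properties using (m^n≢0)
open import Data.Bool using (Bool; true; false; if_then_else_; _∧_)
open import Data.List using (List; []; _∷_; length; drop; lookup; filter; upTo; foldr)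
open import Data.Product using (_×_; _,_; proj₁; proj₂)
open import Data.Fin using (Fin; toℕ)
open import Data.Integer using (+_)
open import Data.Rational using (ℚ; 0ℚ)
import Data.Rational as Q
open import Relation.Nullary.Decidable using (⌊_⌋)
open import Relation.Unary using (Pred)

_/2^_ : ℕ → ℕ → ℕ
x /2^ k = _/_ x (2 ^ k) {{m^n≢0 2 k}}

_%2^_ : ℕ → ℕ → ℕ
x %2^ k = _%_ x (2 ^ k) {{m^n≢0 2 k}}

wt : (k x : ℕ) → ℕ
wt zero    x = 0
wt (suc k) x = x % 2 + wt k (x / 2)

toBits : (n x : ℕ) → List Bool
toBits zero    x = []
toBits (suc k) x = ((x /2^ k) % 2 ≡ᵇ 1) ∷ toBits k x

-- Maximal runs of equal bits: list of (bit, run length), MSB first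

runs : List Bool → List (Bool × ℕ)
runs []       = []
runs (b ∷ bs) with runs bs
... | []              = (b , 1) ∷ []
... | (b' , l) ∷ rest = if eqB b b' then (b , suc l) ∷ rest
                                    else (b , 1) ∷ (b' , l) ∷ rest
  where
  eqB : Bool → Bool → Bool
  eqB true  true  = true
  eqB false false = true
  eqB _     _     = false

totalLen : List (Bool × ℕ) → ℕ
totalLen = foldr (λ p r → proj₂ p + r) 0

blocks : (n α : ℕ) → List (Bool × ℕ)
blocks n α = runs (toBits n α)

numBlocks : (n α : ℕ) → ℕ
numBlocks n α = length (blocks n α)

-- Block data, with 0-based block index j : Fin m (block j+1 of the paper)

blockVal : (R L x : ℕ) → ℕ
blockVal R L x = (x /2^ R) %2^ L

blockLen : (n α : ℕ) → Fin (numBlocks n α) → ℕ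
blockLen n α j = proj₂ (lookup (blocks n α) j)

blockBit : (n α : ℕ) → Fin (numBlocks n α) → Bool
blockBit n α j = proj₁ (lookup (blocks n α) j)

-- number of bits strictly less significant than block i
blockOff : (n α : ℕ) → Fin (numBlocks n α) → ℕ
blockOff n α j = totalLen (drop (suc (toℕ j)) (blocks n α))

Tof : (n α S : ℕ) → ℕ
Tof n α S = (S + α) %2^ n

Xi : (n α : ℕ) → Fin (numBlocks n α) → ℕ → ℕ
Xi n α j S = wt (blockLen n α j) (blockVal (blockOff n α j) (blockLen n α j) S)

Yi : (n α : ℕ) → Fin (numBlocks n α) → ℕ → ℕ
Yi n α j S = wt (blockLen n α j) (blockVal (blockOff n α j) (blockLen n α j) (Tof n α S))

-- Carry out of the first block of the suffix `bs` of the block list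
-- (bs = σ_i ⋯ σ_m gives c_i; bs = [] gives c_{m+1} = 0).
carryOut : (α S : ℕ) → List (Bool × ℕ) → Bool
carryOut α S []             = false
carryOut α S ((b , L) ∷ bs) =
  let R   = totalLen bs
      cin = if carryOut α S bs then 1 else 0
  in  2 ^ L ≤ᵇ blockVal R L S + blockVal R L α + cin

-- c_{i+1}: carry into block i
cIn : (n α : ℕ) → Fin (numBlocks n α) → ℕ → Bool
cIn n α j S = carryOut α S (drop (suc (toℕ j)) (blocks n α))

-- c_i: carry out of block i
cOut : (n α : ℕ) → Fin (numBlocks n α) → ℕ → Bool
cOut n α j S = carryOut α S (drop (toℕ j) (blocks n α))

count : (ℕ → Bool) → ℕ → ℕ
count P N = length (filter (λ s → P s ≡ᵇ' true) (upTo N))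
  where
  open import Data.Bool.Properties using () renaming (_≟_ to _≡ᵇ'_)

-- a / d as a rational, with the convention a / 0 = 0 (only used for d > 0)
frac : ℕ → ℕ → ℚ
frac a zero    = 0ℚ
frac a (suc d) = (+ a) Q./ suc d

condEv : (n α : ℕ) → Fin (numBlocks n α) → Bool → Bool → ℕ → Bool
condEv n α j a b S = eqB (cIn n α j S) a ∧ eqB (cOut n α j S) b
  where
  eqB : Bool → Bool → Bool
  eqB true  true  = true
  eqB false false = true
  eqB _     _     = false

-- P(c_{i+1} = a, c_i = b) > 0   (as a count over the 2^n equally likely S)
condPos : (n α : ℕ) → Fin (numBlocks n α) → Bool → Bool → Set
condPos n α j a b = 0 < count (condEv n α j a b) (2 ^ n)

pmf : (n α : ℕ) → Fin (numBlocks n α) → (a b : Bool) → (x y : ℕ) → ℚ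
pmf n α j a b x y =
  frac (count (λ S → condEv n α j a b S ∧ (Xi n α j S ≡ᵇ x) ∧ (Yi n α j S ≡ᵇ y)) (2 ^ n))
       (count (condEv n α j a b) (2 ^ n))

-- Write S = (h * 2^L + s) * 2^R + l, where s is the value of the block S_i and l that of the R bits
-- below it.  The carry c_{i+1} into the block depends on l alone, while c_i, X_i = wt s and Y_i are
-- functions of s and c_{i+1}; so all events involved are product events, and the conditional pmf
-- is a ratio of counts over the 2^L values of s.  For σ_i = 1^L the block adds 2^L - 1 + c_{i+1}
-- to s.  With a carry in, T_i = S_i and c_i = 1, which gives the binomial law on the diagonal.
-- Without one, S_i = 0 gives T_i = 1^L and c_i = 0, while each of the 2^L - 1 values s ≥ 1 gives
-- T_i = s - 1 and c_i = 1.  Writing s = u10^t, so that s - 1 = u01^t, the pairs with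
-- (wt s, wt (s - 1)) = (x, y) have t = y - x + 1 and u an (L - 1 - t)-bit word of weight x - 1,
-- whence the count C(L - y + x - 2, x - 1); it is computed by recursion on the lowest bit of s.

module Submission where

open import Defs
open import Data.Nat
open import Data.Nat.Properties
open import Data.Nat.DivMod
open import Data.Nat.Divisibility using (divides; ∣-refl; n∣m*n)
open import Data.Nat.Combinatorics using (_C_; nCk+nC[k+1]≡[n+1]C[k+1]; k>n⇒nCk≡0)
open import Data.Bool using (Bool; true; false; _∧_; if_then_else_; T)
open import Data.Bool.Properties using (∧-assoc; ∧-idem; ∧-zeroʳ; ∧-identityʳ) renaming (_≟_ to _≟ᵇ_)
open import Data.List using (List; []; _∷_; _++_; length; take; drop; lookup; replicate; filter; applyUpTo)
open import Data.List.Properties using (length-++; length-replicate; ++-assoc; ∷-injectiveʳ; ∷-injectiveˡ; take++drop≡id)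
open import Data.Product using (_×_; _,_; proj₁; proj₂)
open import Data.Fin using (Fin; toℕ)
import Data.Fin as Fin
import Data.Integer as ℤ
import Data.Integer.Properties as ℤₚ
open import Data.Rational using (ℚ; 0ℚ; 1ℚ)
import Data.Rational.Properties as ℚₚ
import Data.Rational.Unnormalised as ℚᵘ
open import Data.Empty using (⊥-elim)
open import Function using (id; _∘_; mk⇔)
open import Relation.Nullary using (¬_; yes; no; does; ofʸ; ofⁿ)
open import Relation.Nullary.Decidable using (dec-true; dec-false; does-⇔)
open import Relation.Binary.PropositionalEquality
open import Algebra.Properties.CommutativeSemigroup +-commutativeSemigroup using () renaming (interchange to +-interchange)

-- Counting
𝟙 : Bool → ℕ
𝟙 b = if b then 1 else 0

tally : (ℕ → Bool) → ℕ → ℕ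
tally P zero    = 0
tally P (suc N) = 𝟙 (P 0) + tally (P ∘ suc) N

count≡tally : ∀ P N → count P N ≡ tally P N
count≡tally P N = filter-applyUpTo id N
  where
  filter-applyUpTo : ∀ f N → length (filter (λ s → P s ≟ᵇ true) (applyUpTo f N)) ≡ tally (P ∘ f) N
  filter-applyUpTo f zero = refl
  filter-applyUpTo f (suc N) with P (f 0)
  ... | true  = cong suc (filter-applyUpTo (f ∘ suc) N)
  ... | false = filter-applyUpTo (f ∘ suc) N

tally-cong : ∀ {P Q} N → (∀ s → s < N → P s ≡ Q s) → tally P N ≡ tally Q N
tally-cong zero    eq = refl
tally-cong (suc N) eq = cong₂ _+_ (cong 𝟙 (eq 0 z<s)) (tally-cong N (λ s s<N → eq (suc s) (s<s s<N)))

tally-false : ∀ N → tally (λ _ → false) N ≡ 0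
tally-false zero    = refl
tally-false (suc N) = tally-false N

tally-true : ∀ N → tally (λ _ → true) N ≡ N
tally-true zero    = refl
tally-true (suc N) = cong suc (tally-true N)

tally-+ : ∀ P a b → tally P (a + b) ≡ tally P a + tally (λ s → P (a + s)) b
tally-+ P zero    b = refl
tally-+ P (suc a) b = trans (cong (𝟙 (P 0) +_) (tally-+ (P ∘ suc) a b)) (sym (+-assoc (𝟙 (P 0)) _ _))

tally-* : ∀ A B K M .{{_ : NonZero M}} →
          tally (λ S → A (S / M) ∧ B (S % M)) (K * M) ≡ tally A K * tally B M
tally-* A B zero    M = refl
tally-* A B (suc K) M = begin
  tally P (M + K * M)                                      ≡⟨ tally-+ P M (K * M) ⟩
  tally P M + tally (λ s → P (M + s)) (K * M)              ≡⟨ cong₂ _+_ lowest higher ⟩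
  𝟙 (A 0) * tally B M + tally (A ∘ suc) K * tally B M      ≡⟨ *-distribʳ-+ (tally B M) (𝟙 (A 0)) _ ⟨
  (𝟙 (A 0) + tally (A ∘ suc) K) * tally B M                ∎
  where
  open ≡-Reasoning
  P : ℕ → Bool
  P S = A (S / M) ∧ B (S % M)
  lowest : tally P M ≡ 𝟙 (A 0) * tally B M
  lowest = trans (tally-cong M (λ s s<M → cong₂ (λ u v → A u ∧ B v) (m<n⇒m/n≡0 s<M) (m<n⇒m%n≡m s<M)))
                 (tally-∧ˡ (A 0))
    where
    tally-∧ˡ : ∀ b → tally (λ s → b ∧ B s) M ≡ 𝟙 b * tally B M
    tally-∧ˡ true  = sym (+-identityʳ (tally B M))
    tally-∧ˡ false = tally-false M
  shift : ∀ s → P (M + s) ≡ A (suc (s / M)) ∧ B (s % M)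
  shift s = cong₂ (λ u v → A u ∧ B v)
    (trans (/-congˡ (+-comm M s)) (trans (+-distrib-/-∣ʳ s ∣-refl) (trans (cong (s / M +_) (n/n≡1 M)) (+-comm (s / M) 1))))
    (trans (%-congˡ (+-comm M s)) ([m+n]%n≡m%n s M))
  higher : tally (λ s → P (M + s)) (K * M) ≡ tally (A ∘ suc) K * tally B M
  higher = trans (tally-cong (K * M) (λ s _ → shift s)) (tally-* (A ∘ suc) B K M)

tally-*2 : ∀ P K → tally P (K * 2) ≡ tally (λ t → P (t * 2)) K + tally (λ t → P (suc (t * 2))) K
tally-*2 P zero    = refl
tally-*2 P (suc K) = trans (cong (λ z → 𝟙 (P 0) + (𝟙 (P 1) + z)) (tally-*2 (P ∘ suc ∘ suc) K))
                           (trans (sym (+-assoc (𝟙 (P 0)) (𝟙 (P 1)) _)) (+-interchange (𝟙 (P 0)) (𝟙 (P 1)) _ _))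

tally-2^suc : ∀ P L → tally P (2 ^ suc L) ≡ tally (λ t → P (t * 2)) (2 ^ L) + tally (λ t → P (suc (t * 2))) (2 ^ L)
tally-2^suc P L = trans (cong (tally P) (*-comm 2 (2 ^ L))) (tally-*2 P (2 ^ L))

frac-0 : ∀ d → frac 0 d ≡ 0ℚ
frac-0 zero    = refl
frac-0 (suc d) = ℚₚ.0/n≡0 (suc d)

frac-*-cancelʳ : ∀ a b k → 0 < b * k → frac (a * k) (b * k) ≡ frac a b
frac-*-cancelʳ a zero    k       ()
frac-*-cancelʳ a (suc b) zero    0<b*0 = ⊥-elim (<-irrefl (sym (*-zeroʳ (suc b))) 0<b*0)
frac-*-cancelʳ a (suc b) (suc k) _     =
  ℚₚ.fromℚᵘ-cong {ℚᵘ.mkℚᵘ (ℤ.+ (a * suc k)) (k + b * suc k)} {ℚᵘ.mkℚᵘ (ℤ.+ a) b} (ℚᵘ.*≡* (begin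
    ℤ.+ (a * suc k) ℤ.* ℤ.+ suc b ≡⟨ ℤₚ.pos-* (a * suc k) (suc b) ⟨
    ℤ.+ (a * suc k * suc b)       ≡⟨ cong ℤ.+_ (*-assoc a (suc k) (suc b)) ⟩
    ℤ.+ (a * (suc k * suc b))     ≡⟨ cong (λ z → ℤ.+ (a * z)) (*-comm (suc k) (suc b)) ⟩
    ℤ.+ (a * (suc b * suc k))     ≡⟨ ℤₚ.pos-* a (suc b * suc k) ⟩
    ℤ.+ a ℤ.* ℤ.+ (suc b * suc k) ∎))
  where open ≡-Reasoning

frac-*-cancel-outer : ∀ K g c Q → 0 < K * c * Q → frac (K * g * Q) (K * c * Q) ≡ frac g c
frac-*-cancel-outer K g c Q 0<KcQ = trans (cong₂ frac (rearrange g) (rearrange c))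
                                          (frac-*-cancelʳ g c (K * Q) (subst (0 <_) (rearrange c) 0<KcQ))
  where
  rearrange : ∀ z → K * z * Q ≡ z * (K * Q)
  rearrange z = trans (cong (_* Q) (*-comm K z)) (*-assoc z K Q)

-- Arithmetic of blocks of bits
2^-+ : ∀ a b → 2 ^ (a + b) ≡ 2 ^ a * 2 ^ b
2^-+ = ^-distribˡ-+-* 2

≤ᵇ-/ : ∀ N X M .{{_ : NonZero M}} → (N ≤ᵇ X / M) ≡ (N * M ≤ᵇ X)
≤ᵇ-/ N X M = does-⇔ (mk⇔ to from) (N ≤? X / M) (N * M ≤? X)
  where
  to : N ≤ X / M → N * M ≤ X
  to N≤ = ≤-trans (*-monoˡ-≤ M N≤) (m/n*n≤m X M)
  from : N * M ≤ X → N ≤ X / M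
  from NM≤ = subst (_≤ X / M) (m*n/n≡m N M) (/-monoˡ-≤ M NM≤)

[a+b]/d≡carry : ∀ {a b d} .{{_ : NonZero d}} → a < d → b < d → (a + b) / d ≡ 𝟙 (d ≤ᵇ a + b)
[a+b]/d≡carry {a} {b} {d} a<d b<d with d ≤ᵇ a + b | ≤ᵇ-reflects-≤ d (a + b)
... | true  | ofʸ d≤ = trans (m/n≡1+[m∸n]/n d≤) (cong suc (m<n⇒m/n≡0 (+-cancelʳ-< _ _ d (begin-strict
  a + b ∸ d + d ≡⟨ m∸n+n≡m d≤ ⟩
  a + b         <⟨ +-mono-< a<d b<d ⟩
  d + d         ∎))))
  where open ≤-Reasoning
... | false | ofⁿ d≰ = m<n⇒m/n≡0 (≰⇒> d≰)

+-distrib-/-carry : ∀ x y d .{{_ : NonZero d}} → (x + y) / d ≡ x / d + y / d + 𝟙 (d ≤ᵇ x % d + y % d)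
+-distrib-/-carry x y d = begin
  (x + y) / d
    ≡⟨ /-congˡ (trans (cong₂ _+_ (m≡m%n+[m/n]*n x d) (m≡m%n+[m/n]*n y d)) (+-interchange (x % d) _ _ _)) ⟩
  ((x % d + y % d) + (x / d * d + y / d * d)) / d
    ≡⟨ /-congˡ (cong ((x % d + y % d) +_) (*-distribʳ-+ d (x / d) (y / d))) ⟨
  ((x % d + y % d) + (x / d + y / d) * d) / d
    ≡⟨ +-distrib-/-∣ʳ (x % d + y % d) (n∣m*n (x / d + y / d)) ⟩
  (x % d + y % d) / d + (x / d + y / d) * d / d
    ≡⟨ cong₂ _+_ ([a+b]/d≡carry (m%n<n x d) (m%n<n y d)) (m*n/n≡m (x / d + y / d) d) ⟩
  𝟙 (d ≤ᵇ x % d + y % d) + (x / d + y / d)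
    ≡⟨ +-comm (𝟙 (d ≤ᵇ x % d + y % d)) _ ⟩
  x / d + y / d + 𝟙 (d ≤ᵇ x % d + y % d) ∎
  where open ≡-Reasoning

%2^-/2^ : ∀ x L R → (x %2^ (L + R)) /2^ R ≡ blockVal R L x
%2^-/2^ x L R = trans (cong (_/ 2 ^ R) (%-congʳ (2^-+ L R))) (m%[n*o]/o≡m/o%n x (2 ^ L) (2 ^ R))
  where instance
  _ = m^n≢0 2 L
  _ = m^n≢0 2 R
  _ = m^n≢0 2 (L + R)
  _ = m*n≢0 (2 ^ L) (2 ^ R)

%2^-%2^ : ∀ x a R → (x %2^ (a + R)) %2^ R ≡ x %2^ R
%2^-%2^ x a R = m∣n⇒o%n%m≡o%m (2 ^ R) (2 ^ (a + R)) x (divides (2 ^ a) (2^-+ a R))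
  where instance
  _ = m^n≢0 2 R
  _ = m^n≢0 2 (a + R)

blockVal-%2^ : ∀ x k L R → blockVal R L (x %2^ ((k + L) + R)) ≡ blockVal R L x
blockVal-%2^ x k L R = trans (cong (_%2^ L) (%2^-/2^ x (k + L) R)) (%2^-%2^ (x /2^ R) k L)

/2^-/2^ : ∀ x L R → (x /2^ R) /2^ L ≡ x /2^ (L + R)
/2^-/2^ x L R = trans (m/n/o≡m/[n*o] x (2 ^ R) (2 ^ L)) (/-congʳ (trans (*-comm (2 ^ R) (2 ^ L)) (sym (2^-+ L R))))
  where instance
  _ = m^n≢0 2 L
  _ = m^n≢0 2 R
  _ = m^n≢0 2 (L + R)
  _ = m*n≢0 (2 ^ R) (2 ^ L)

%2^-+ : ∀ y a b → y %2^ (a + b) ≡ blockVal b a y * 2 ^ b + y %2^ b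
%2^-+ y a b = begin
  y %2^ (a + b)                                         ≡⟨ m≡m%n+[m/n]*n (y %2^ (a + b)) (2 ^ b) ⟩
  (y %2^ (a + b)) %2^ b + (y %2^ (a + b)) /2^ b * 2 ^ b ≡⟨ cong₂ (λ u v → u + v * 2 ^ b) (%2^-%2^ y a b) (%2^-/2^ y a b) ⟩
  y %2^ b + blockVal b a y * 2 ^ b                      ≡⟨ +-comm (y %2^ b) _ ⟩
  blockVal b a y * 2 ^ b + y %2^ b                      ∎
  where
  open ≡-Reasoning
  instance _ = m^n≢0 2 b

lowCarry : ℕ → ℕ → ℕ → Bool
lowCarry R S α = 2 ^ R ≤ᵇ S %2^ R + α %2^ R

/2^-+ : ∀ S α R → (S + α) /2^ R ≡ S /2^ R + α /2^ R + 𝟙 (lowCarry R S α)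
/2^-+ S α R = +-distrib-/-carry S α (2 ^ R) {{m^n≢0 2 R}}

carryOut≡lowCarry : ∀ α S bs → carryOut α S bs ≡ lowCarry (totalLen bs) S α
carryOut≡lowCarry α S []             = sym (cong₂ (λ u v → 1 ≤ᵇ u + v) (n%1≡0 S) (n%1≡0 α))
carryOut≡lowCarry α S ((_ , L) ∷ bs) = begin
  2 ^ L ≤ᵇ blockVal R L S + blockVal R L α + 𝟙 (carryOut α S bs)
    ≡⟨ cong (λ c → 2 ^ L ≤ᵇ blockVal R L S + blockVal R L α + 𝟙 c) (carryOut≡lowCarry α S bs) ⟩
  2 ^ L ≤ᵇ blockVal R L S + blockVal R L α + 𝟙 (lowCarry R S α)
    ≡⟨ cong (2 ^ L ≤ᵇ_) blocks≡ ⟨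
  2 ^ L ≤ᵇ (X + Y) /2^ R
    ≡⟨ ≤ᵇ-/ (2 ^ L) (X + Y) (2 ^ R) {{m^n≢0 2 R}} ⟩
  2 ^ L * 2 ^ R ≤ᵇ X + Y
    ≡⟨ cong (_≤ᵇ X + Y) (2^-+ L R) ⟨
  2 ^ (L + R) ≤ᵇ X + Y ∎
  where
  open ≡-Reasoning
  R X Y : ℕ
  R = totalLen bs
  X = S %2^ (L + R)
  Y = α %2^ (L + R)
  blocks≡ : (X + Y) /2^ R ≡ blockVal R L S + blockVal R L α + 𝟙 (lowCarry R S α)
  blocks≡ = trans (/2^-+ X Y R) (trans
    (cong₂ (λ u v → u + v + 𝟙 (lowCarry R X Y)) (%2^-/2^ S L R) (%2^-/2^ α L R))
    (cong (λ w → blockVal R L S + blockVal R L α + 𝟙 (2 ^ R ≤ᵇ w)) (cong₂ _+_ (%2^-%2^ S L R) (%2^-%2^ α L R))))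

blockVal-+ : ∀ S α L R → blockVal R L (S + α) ≡ (blockVal R L S + blockVal R L α + 𝟙 (lowCarry R S α)) %2^ L
blockVal-+ S α L R = begin
  ((S + α) /2^ R) % N                                  ≡⟨ cong (_% N) (/2^-+ S α R) ⟩
  (S /2^ R + α /2^ R + c) % N                          ≡⟨ %-distribˡ-+ (S /2^ R + α /2^ R) c N ⟩
  ((S /2^ R + α /2^ R) % N + c % N) % N                ≡⟨ cong (λ z → (z + c % N) % N) (%-distribˡ-+ (S /2^ R) (α /2^ R) N) ⟩
  ((S /2^ R % N + α /2^ R % N) % N + c % N) % N        ≡⟨ %-distribˡ-+ (S /2^ R % N + α /2^ R % N) c N ⟨
  (S /2^ R % N + α /2^ R % N + c) % N                  ∎
  where
  open ≡-Reasoning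
  N c : ℕ
  N = 2 ^ L
  c = 𝟙 (lowCarry R S α)
  instance _ = m^n≢0 2 L

-- S < 2 ^ ((k + L) + R) is (h * 2 ^ L + s) * 2 ^ R + l with h < 2 ^ k, s < 2 ^ L and l < 2 ^ R.
tally-block : ∀ (G E : ℕ → Bool) k L R →
  tally (λ S → G (blockVal R L S) ∧ E (S %2^ R)) (2 ^ ((k + L) + R)) ≡ 2 ^ k * tally G (2 ^ L) * tally E (2 ^ R)
tally-block G E k L R = begin
  tally (λ S → G (blockVal R L S) ∧ E (S %2^ R)) (2 ^ ((k + L) + R))
    ≡⟨ cong (tally _) (trans (2^-+ (k + L) R) (cong (_* 2 ^ R) (2^-+ k L))) ⟩
  tally (λ S → G (blockVal R L S) ∧ E (S %2^ R)) (2 ^ k * 2 ^ L * 2 ^ R)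
    ≡⟨ tally-* (λ h → G (h %2^ L)) E (2 ^ k * 2 ^ L) (2 ^ R) ⟩
  tally (λ h → G (h %2^ L)) (2 ^ k * 2 ^ L) * tally E (2 ^ R)
    ≡⟨ cong (_* tally E (2 ^ R)) (tally-* (λ _ → true) G (2 ^ k) (2 ^ L)) ⟩
  tally (λ _ → true) (2 ^ k) * tally G (2 ^ L) * tally E (2 ^ R)
    ≡⟨ cong (λ z → z * tally G (2 ^ L) * tally E (2 ^ R)) (tally-true (2 ^ k)) ⟩
  2 ^ k * tally G (2 ^ L) * tally E (2 ^ R) ∎
  where
  open ≡-Reasoning
  instance
    _ = m^n≢0 2 L
    _ = m^n≢0 2 R

-- The runs of α
length-toBits : ∀ n x → length (toBits n x) ≡ n
length-toBits zero    x = refl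
length-toBits (suc n) x = cong suc (length-toBits n x)

toBits-suffix : ∀ n x P Q → toBits n x ≡ P ++ Q → toBits (length Q) x ≡ Q
toBits-suffix n       x []      Q eq = trans (cong (λ m → toBits m x) (trans (cong length (sym eq)) (length-toBits n x))) eq
toBits-suffix (suc n) x (_ ∷ P) Q eq = toBits-suffix n x P Q (∷-injectiveʳ eq)

blockVal-ones : ∀ L R x E → length E ≡ R → toBits (L + R) x ≡ replicate L true ++ E → blockVal R L x ≡ 2 ^ L ∸ 1
blockVal-ones zero    R x E _    _  = n%1≡0 (x /2^ R)
blockVal-ones (suc L) R x E |E| eq = begin
  (x /2^ R) %2^ (1 + L)                              ≡⟨ %2^-+ (x /2^ R) 1 L ⟩
  ((x /2^ R) /2^ L) % 2 * 2 ^ L + (x /2^ R) %2^ L    ≡⟨ cong₂ (λ u v → u * 2 ^ L + v) (trans (cong (_% 2) (/2^-/2^ x L R)) topBit)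
                                                                                       (blockVal-ones L R x E |E| (∷-injectiveʳ eq)) ⟩
  1 * 2 ^ L + (2 ^ L ∸ 1)                            ≡⟨ cong (_+ (2 ^ L ∸ 1)) (*-identityˡ (2 ^ L)) ⟩
  2 ^ L + (2 ^ L ∸ 1)                                ≡⟨ +-∸-assoc (2 ^ L) (m^n>0 2 L) ⟨
  2 ^ L + 2 ^ L ∸ 1                                  ≡⟨ cong (λ z → 2 ^ L + z ∸ 1) (+-identityʳ (2 ^ L)) ⟨
  2 ^ suc L ∸ 1                                      ∎
  where
  open ≡-Reasoning
  topBit : (x /2^ (L + R)) % 2 ≡ 1
  topBit = ≡ᵇ⇒≡ _ 1 (subst T (sym (∷-injectiveˡ eq)) _)

decodeRuns : List (Bool × ℕ) → List Bool
decodeRuns []             = []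
decodeRuns ((b , L) ∷ bs) = replicate L b ++ decodeRuns bs

decodeRuns-runs : ∀ bs → decodeRuns (runs bs) ≡ bs
decodeRuns-runs []       = refl
decodeRuns-runs (b ∷ bs) with runs bs | decodeRuns-runs bs
... | []             | refl = refl
... | (b′ , _) ∷ _   | ih with b | b′
...   | true  | true  = cong (true ∷_) ih
...   | false | false = cong (false ∷_) ih
...   | true  | false = cong (true ∷_) ih
...   | false | true  = cong (false ∷_) ih

decodeRuns-++ : ∀ xs ys → decodeRuns (xs ++ ys) ≡ decodeRuns xs ++ decodeRuns ys
decodeRuns-++ []             ys = refl
decodeRuns-++ ((b , L) ∷ xs) ys = trans (cong (replicate L b ++_) (decodeRuns-++ xs ys)) (sym (++-assoc (replicate L b) _ _))

length-decodeRuns : ∀ xs → length (decodeRuns xs) ≡ totalLen xs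
length-decodeRuns []             = refl
length-decodeRuns ((b , L) ∷ xs) = trans (length-++ (replicate L b)) (cong₂ _+_ (length-replicate L) (length-decodeRuns xs))

drop-lookup : ∀ {A : Set} (xs : List A) (i : Fin (length xs)) → drop (toℕ i) xs ≡ lookup xs i ∷ drop (suc (toℕ i)) xs
drop-lookup (x ∷ xs) Fin.zero    = refl
drop-lookup (x ∷ xs) (Fin.suc i) = drop-lookup xs i

module _ (n α : ℕ) (j : Fin (numBlocks n α)) where

  private
    L R : ℕ
    L = blockLen n α j
    R = blockOff n α j
    below : List (Bool × ℕ)
    below = drop (suc (toℕ j)) (blocks n α)
    bits-above bits-below : List Bool
    bits-above = decodeRuns (take (toℕ j) (blocks n α))
    bits-below = decodeRuns below

  toBits-at-block : toBits n α ≡ bits-above ++ (replicate L (blockBit n α j) ++ bits-below)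
  toBits-at-block = begin
    toBits n α
      ≡⟨ decodeRuns-runs (toBits n α) ⟨
    decodeRuns (blocks n α)
      ≡⟨ cong decodeRuns (take++drop≡id (toℕ j) (blocks n α)) ⟨
    decodeRuns (take (toℕ j) (blocks n α) ++ drop (toℕ j) (blocks n α))
      ≡⟨ decodeRuns-++ (take (toℕ j) (blocks n α)) _ ⟩
    bits-above ++ decodeRuns (drop (toℕ j) (blocks n α))
      ≡⟨ cong (λ bs → bits-above ++ decodeRuns bs) (drop-lookup (blocks n α) j) ⟩
    bits-above ++ (replicate L (blockBit n α j) ++ bits-below) ∎
    where open ≡-Reasoning

  length-block+below : ∀ b → length (replicate L b ++ bits-below) ≡ L + R
  length-block+below b = trans (length-++ (replicate L b)) (cong₂ _+_ (length-replicate L) (length-decodeRuns below))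

  n≡above+blockLen+blockOff : n ≡ (length bits-above + L) + R
  n≡above+blockLen+blockOff = begin
    n                                                                       ≡⟨ length-toBits n α ⟨
    length (toBits n α)                                                     ≡⟨ cong length toBits-at-block ⟩
    length (bits-above ++ (replicate L (blockBit n α j) ++ bits-below))     ≡⟨ length-++ bits-above ⟩
    length bits-above + length (replicate L (blockBit n α j) ++ bits-below) ≡⟨ cong (length bits-above +_) (length-block+below _) ⟩
    length bits-above + (L + R)                                             ≡⟨ +-assoc (length bits-above) L R ⟨
    length bits-above + L + R                                               ∎
    where open ≡-Reasoning

  blockVal-α-ones : blockBit n α j ≡ true → blockVal R L α ≡ 2 ^ L ∸ 1
  blockVal-α-ones bit = blockVal-ones L R α bits-below (length-decodeRuns below)
    (subst (λ m → toBits m α ≡ replicate L true ++ bits-below) (length-block+below true)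
      (toBits-suffix n α bits-above _ toBits-at-ones))
    where
    toBits-at-ones : toBits n α ≡ bits-above ++ (replicate L true ++ bits-below)
    toBits-at-ones = subst (λ b → toBits n α ≡ bits-above ++ (replicate L b ++ bits-below)) bit toBits-at-block

-- Hamming weights
wt-0 : ∀ L → wt L 0 ≡ 0
wt-0 zero    = refl
wt-0 (suc L) = wt-0 L

wt-*2 : ∀ L t → wt (suc L) (t * 2) ≡ wt L t
wt-*2 L t = cong₂ (λ u v → u + wt L v) (m*n%n≡0 t 2) (m*n/n≡m t 2)

wt-1+*2 : ∀ L t → wt (suc L) (suc (t * 2)) ≡ suc (wt L t)
wt-1+*2 L t = cong₂ (λ u v → u + wt L v) ([m+kn]%n≡m%n 1 t 2) (trans (+-distrib-/-∣ʳ 1 {d = 2} (n∣m*n t)) (m*n/n≡m t 2))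

wt-2^∸1 : ∀ L → wt L (2 ^ L ∸ 1) ≡ L
wt-2^∸1 zero    = refl
wt-2^∸1 (suc L) = trans (cong (wt (suc L)) 2^[1+L]∸1) (trans (wt-1+*2 L _) (cong suc (wt-2^∸1 L)))
  where
  2^[1+L]∸1 : 2 ^ suc L ∸ 1 ≡ suc ((2 ^ L ∸ 1) * 2)
  2^[1+L]∸1 with 2 ^ L | m^n>0 2 L
  ... | suc m | _ = trans (+-suc m (m + 0)) (cong suc (*-comm 2 m))

tally-wt≡ : ∀ L x → tally (λ s → wt L s ≡ᵇ x) (2 ^ L) ≡ L C x
tally-wt≡ zero    zero    = refl
tally-wt≡ zero    (suc x) = refl
tally-wt≡ (suc L) x = begin
  tally (λ s → wt (suc L) s ≡ᵇ x) (2 ^ suc L)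
    ≡⟨ tally-2^suc _ L ⟩
  tally (λ t → wt (suc L) (t * 2) ≡ᵇ x) (2 ^ L) + tally (λ t → wt (suc L) (suc (t * 2)) ≡ᵇ x) (2 ^ L)
    ≡⟨ cong₂ _+_ (tally-cong (2 ^ L) (λ t _ → cong (_≡ᵇ x) (wt-*2 L t)))
                 (tally-cong (2 ^ L) (λ t _ → cong (_≡ᵇ x) (wt-1+*2 L t))) ⟩
  tally (λ t → wt L t ≡ᵇ x) (2 ^ L) + tally (λ t → suc (wt L t) ≡ᵇ x) (2 ^ L)
    ≡⟨ cong (_+ tally (λ t → suc (wt L t) ≡ᵇ x) (2 ^ L)) (tally-wt≡ L x) ⟩
  L C x + tally (λ t → suc (wt L t) ≡ᵇ x) (2 ^ L)
    ≡⟨ pascal x ⟩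
  suc L C x ∎
  where
  open ≡-Reasoning
  pascal : ∀ x → L C x + tally (λ t → suc (wt L t) ≡ᵇ x) (2 ^ L) ≡ suc L C x
  pascal zero     = cong (L C 0 +_) (tally-false (2 ^ L))
  pascal (suc x′) = trans (cong (L C suc x′ +_) (tally-wt≡ L x′))
                          (trans (+-comm (L C suc x′) _) (nCk+nC[k+1]≡[n+1]C[k+1] L x′))

≡ᵇ∧≡ᵇ-≢ : ∀ {u v} → u ≢ v → ∀ w → ((w ≡ᵇ u) ∧ (w ≡ᵇ v)) ≡ false
≡ᵇ∧≡ᵇ-≢ {u} {v} u≢v w with w ≟ u
... | yes refl = trans (cong (_∧ (u ≡ᵇ v)) (dec-true (u ≟ u) refl)) (dec-false (u ≟ v) u≢v)
... | no  w≢u  = cong (_∧ (w ≡ᵇ v)) (dec-false (w ≟ u) w≢u)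

tally-wt≡-wt≡ : ∀ L u → tally (λ t → (wt L t ≡ᵇ u) ∧ (wt L t ≡ᵇ u)) (2 ^ L) ≡ L C u
tally-wt≡-wt≡ L u = trans (tally-cong (2 ^ L) (λ t _ → ∧-idem (wt L t ≡ᵇ u))) (tally-wt≡ L u)

tally-wt≡-wt≢ : ∀ L {u v} → u ≢ v → tally (λ t → (wt L t ≡ᵇ u) ∧ (wt L t ≡ᵇ v)) (2 ^ L) ≡ 0
tally-wt≡-wt≢ L u≢v = trans (tally-cong (2 ^ L) (λ t _ → ≡ᵇ∧≡ᵇ-≢ u≢v (wt L t))) (tally-false (2 ^ L))

predWeights : ℕ → ℕ → ℕ → ℕ → Bool
predWeights L x y s = (1 ≤ᵇ s) ∧ ((wt L s ≡ᵇ x) ∧ (wt L (s ∸ 1) ≡ᵇ y))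

predWeightCount : ℕ → ℕ → ℕ → ℕ
predWeightCount L x y = tally (predWeights L x y) (2 ^ L)

module _ (L x : ℕ) where

  private
    odd : ℕ → ℕ
    odd y = tally (λ t → (suc (wt L t) ≡ᵇ x) ∧ (wt L t ≡ᵇ y)) (2 ^ L)

    predWeightCount-suc : ∀ y → predWeightCount (suc L) x y ≡ tally (λ t → predWeights (suc L) x y (t * 2)) (2 ^ L) + odd y
    predWeightCount-suc y = trans (tally-2^suc (predWeights (suc L) x y) L)
      (cong (tally (λ t → predWeights (suc L) x y (t * 2)) (2 ^ L) +_)
            (tally-cong (2 ^ L) (λ t _ → cong₂ (λ u v → (u ≡ᵇ x) ∧ (v ≡ᵇ y)) (wt-1+*2 L t) (wt-*2 L t))))

  predWeightCount-suc-zero : predWeightCount (suc L) x 0 ≡ tally (λ t → (suc (wt L t) ≡ᵇ x) ∧ (wt L t ≡ᵇ 0)) (2 ^ L)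
  predWeightCount-suc-zero = trans (predWeightCount-suc 0) (cong (_+ odd 0) (trans (tally-cong (2 ^ L) even) (tally-false (2 ^ L))))
    where
    even : ∀ t → t < 2 ^ L → predWeights (suc L) x 0 (t * 2) ≡ false
    even zero    _ = refl
    even (suc t) _ = trans (cong (λ v → (wt (suc L) (suc t * 2) ≡ᵇ x) ∧ (v ≡ᵇ 0)) (wt-1+*2 L t)) (∧-zeroʳ _)

  predWeightCount-suc-suc : ∀ y → predWeightCount (suc L) x (suc y)
                                  ≡ predWeightCount L x y + tally (λ t → (suc (wt L t) ≡ᵇ x) ∧ (wt L t ≡ᵇ suc y)) (2 ^ L)
  predWeightCount-suc-suc y = trans (predWeightCount-suc (suc y)) (cong (_+ odd (suc y)) (tally-cong (2 ^ L) even))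
    where
    even : ∀ t → t < 2 ^ L → predWeights (suc L) x (suc y) (t * 2) ≡ predWeights L x y t
    even zero    _ = refl
    even (suc t) _ = cong₂ (λ u v → (u ≡ᵇ x) ∧ (v ≡ᵇ suc y)) (wt-*2 L (suc t)) (wt-1+*2 L t)

predWeightCount≡0 : ∀ L x y → ¬ (1 ≤ x × x ≤ suc y × y < L) → predWeightCount L x y ≡ 0
predWeightCount≡0 zero    x        y        _ = refl
predWeightCount≡0 (suc L) zero     zero     _ = trans (predWeightCount-suc-zero L 0) (tally-false (2 ^ L))
predWeightCount≡0 (suc L) (suc x′) zero     h = trans (predWeightCount-suc-zero L (suc x′))
  (tally-wt≡-wt≢ L (λ { refl → h (s≤s z≤n , s≤s z≤n , s≤s z≤n) }))
predWeightCount≡0 (suc L) zero     (suc y)  h = trans (predWeightCount-suc-suc L 0 y)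
  (cong₂ _+_ (predWeightCount≡0 L 0 y (λ { (() , _) })) (tally-false (2 ^ L)))
predWeightCount≡0 (suc L) (suc x′) (suc y)  h = trans (predWeightCount-suc-suc L (suc x′) y)
  (cong₂ _+_ (predWeightCount≡0 L (suc x′) y (λ (1≤x , x≤1+y , y<L) → h (1≤x , m≤n⇒m≤1+n x≤1+y , s≤s y<L)))
             pairs)
  where
  pairs : tally (λ t → (wt L t ≡ᵇ x′) ∧ (wt L t ≡ᵇ suc y)) (2 ^ L) ≡ 0
  pairs with x′ ≟ suc y
  ... | yes refl = trans (tally-wt≡-wt≡ L (suc y)) (k>n⇒nCk≡0 (≰⇒> (λ 1+y≤L → h (s≤s z≤n , ≤-refl , s≤s 1+y≤L))))
  ... | no  x′≢  = tally-wt≡-wt≢ L x′≢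

predWeightCount≡C : ∀ L x y → x ≤ y → y < L → predWeightCount L (suc x) y ≡ (L ∸ suc y + x) C x
predWeightCount≡C (suc L) zero zero _ _ = trans (predWeightCount-suc-zero L 1) (tally-wt≡-wt≡ L 0)
predWeightCount≡C (suc L) x (suc y) x≤1+y (s≤s y<L) with x ≟ suc y
... | yes refl = begin
  predWeightCount (suc L) (suc (suc y)) (suc y)
    ≡⟨ predWeightCount-suc-suc L (suc (suc y)) y ⟩
  predWeightCount L (suc (suc y)) y + tally (λ t → (wt L t ≡ᵇ suc y) ∧ (wt L t ≡ᵇ suc y)) (2 ^ L)
    ≡⟨ cong₂ _+_ (predWeightCount≡0 L (suc (suc y)) y (λ (_ , 2+y≤1+y , _) → 1+n≰n (≤-pred 2+y≤1+y)))
                 (tally-wt≡-wt≡ L (suc y)) ⟩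
  L C suc y
    ≡⟨ cong (_C suc y) (m∸n+n≡m y<L) ⟨
  (L ∸ suc y + suc y) C suc y ∎
  where open ≡-Reasoning
... | no  x≢1+y = begin
  predWeightCount (suc L) (suc x) (suc y)
    ≡⟨ predWeightCount-suc-suc L (suc x) y ⟩
  predWeightCount L (suc x) y + tally (λ t → (wt L t ≡ᵇ x) ∧ (wt L t ≡ᵇ suc y)) (2 ^ L)
    ≡⟨ cong₂ _+_ (predWeightCount≡C L x y (≤-pred (≤∧≢⇒< x≤1+y x≢1+y)) y<L) (tally-wt≡-wt≢ L x≢1+y) ⟩
  (L ∸ suc y + x) C x + 0
    ≡⟨ +-identityʳ _ ⟩
  (L ∸ suc y + x) C x ∎
  where open ≡-Reasoning

-- Reduction to a single block
blockCarry : (L A : ℕ) → Bool → ℕ → Bool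
blockCarry L A c s = 2 ^ L ≤ᵇ s + A + 𝟙 c

blockSum : (L A : ℕ) → Bool → ℕ → ℕ
blockSum L A c s = (s + A + 𝟙 c) %2^ L

blockEvent : (L A : ℕ) → (a b : Bool) → ℕ → Bool
blockEvent L A a b s = does (blockCarry L A a s ≟ᵇ b)

blockJoint : (L A : ℕ) → (a b : Bool) → (x y : ℕ) → ℕ → Bool
blockJoint L A a b x y s = blockEvent L A a b s ∧ ((wt L s ≡ᵇ x) ∧ (wt L (blockSum L A a s) ≡ᵇ y))

blockJoint-≡ : ∀ L A a s {b x y c t} → blockCarry L A a s ≡ c × blockSum L A a s ≡ t →
               blockJoint L A a b x y s ≡ (does (c ≟ᵇ b) ∧ ((wt L s ≡ᵇ x) ∧ (wt L t ≡ᵇ y)))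
blockJoint-≡ L A a s (refl , refl) = refl

≟ᵇ-∧-subst : ∀ (Z : Bool → Bool) c a → (does (c ≟ᵇ a) ∧ Z c) ≡ (Z a ∧ does (c ≟ᵇ a))
≟ᵇ-∧-subst Z true  true  = sym (∧-identityʳ (Z true))
≟ᵇ-∧-subst Z false false = sym (∧-identityʳ (Z false))
≟ᵇ-∧-subst Z true  false = sym (∧-zeroʳ (Z false))
≟ᵇ-∧-subst Z false true  = sym (∧-zeroʳ (Z true))

blockPmf : (L A : ℕ) → (a b : Bool) → (x y : ℕ) → ℚ
blockPmf L A a b x y = frac (tally (blockJoint L A a b x y) (2 ^ L)) (tally (blockEvent L A a b) (2 ^ L))

module _ (n α : ℕ) (j : Fin (numBlocks n α)) where

  private
    L R A k : ℕ
    L = blockLen n α j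
    R = blockOff n α j
    A = blockVal R L α
    k = length (decodeRuns (take (toℕ j) (blocks n α)))

  cIn≡lowCarry : ∀ S → cIn n α j S ≡ lowCarry R S α
  cIn≡lowCarry S = carryOut≡lowCarry α S (drop (suc (toℕ j)) (blocks n α))

  cOut≡blockCarry : ∀ S → cOut n α j S ≡ blockCarry L A (cIn n α j S) (blockVal R L S)
  cOut≡blockCarry S = cong (carryOut α S) (drop-lookup (blocks n α) j)

  Yi≡wt-blockSum : ∀ S → Yi n α j S ≡ wt L (blockSum L A (cIn n α j S) (blockVal R L S))
  Yi≡wt-blockSum S = cong (wt L) (begin
    blockVal R L ((S + α) %2^ n)                ≡⟨ cong (λ m → blockVal R L ((S + α) %2^ m)) (n≡above+blockLen+blockOff n α j) ⟩
    blockVal R L ((S + α) %2^ ((k + L) + R))    ≡⟨ blockVal-%2^ (S + α) k L R ⟩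
    blockVal R L (S + α)                        ≡⟨ blockVal-+ S α L R ⟩
    blockSum L A (lowCarry R S α) (blockVal R L S) ≡⟨ cong (λ c → blockSum L A c (blockVal R L S)) (cIn≡lowCarry S) ⟨
    blockSum L A (cIn n α j S) (blockVal R L S) ∎)
    where open ≡-Reasoning

  -- condEv compares bits with a function local to Defs, which only computes on constructors.
  condEv≡ : ∀ a b S → condEv n α j a b S ≡ (does (cIn n α j S ≟ᵇ a) ∧ does (cOut n α j S ≟ᵇ b))
  condEv≡ a b S with cIn n α j S | a
  ... | true  | false = refl
  ... | false | true  = refl
  ... | true  | true  with cOut n α j S | b
  ...   | true  | true  = refl
  ...   | true  | false = refl
  ...   | false | true  = refl
  ...   | false | false = refl
  condEv≡ a b S | false | false with cOut n α j S | b
  ...   | true  | true  = refl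
  ...   | true  | false = refl
  ...   | false | true  = refl
  ...   | false | false = refl

  private
    lowEvent : Bool → ℕ → Bool
    lowEvent a l = does ((2 ^ R ≤ᵇ l + α %2^ R) ≟ᵇ a)

    cIn-factor : ∀ (Z : Bool → Bool) a S → (does (cIn n α j S ≟ᵇ a) ∧ Z (cIn n α j S)) ≡ (Z a ∧ lowEvent a (S %2^ R))
    cIn-factor Z a S = trans (≟ᵇ-∧-subst Z (cIn n α j S) a) (cong (λ c → Z a ∧ does (c ≟ᵇ a)) (cIn≡lowCarry S))

  condEv-factor : ∀ a b S → condEv n α j a b S ≡ (blockEvent L A a b (blockVal R L S) ∧ lowEvent a (S %2^ R))
  condEv-factor a b S = begin
    condEv n α j a b S
      ≡⟨ condEv≡ a b S ⟩
    does (cIn n α j S ≟ᵇ a) ∧ does (cOut n α j S ≟ᵇ b)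
      ≡⟨ cong (λ c → does (cIn n α j S ≟ᵇ a) ∧ does (c ≟ᵇ b)) (cOut≡blockCarry S) ⟩
    does (cIn n α j S ≟ᵇ a) ∧ blockEvent L A (cIn n α j S) b (blockVal R L S)
      ≡⟨ cIn-factor (λ c → blockEvent L A c b (blockVal R L S)) a S ⟩
    blockEvent L A a b (blockVal R L S) ∧ lowEvent a (S %2^ R) ∎
    where open ≡-Reasoning

  jointEv-factor : ∀ a b x y S → (condEv n α j a b S ∧ ((Xi n α j S ≡ᵇ x) ∧ (Yi n α j S ≡ᵇ y)))
                                 ≡ (blockJoint L A a b x y (blockVal R L S) ∧ lowEvent a (S %2^ R))
  jointEv-factor a b x y S = begin
    condEv n α j a b S ∧ ((Xi n α j S ≡ᵇ x) ∧ (Yi n α j S ≡ᵇ y))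
      ≡⟨ cong₂ (λ e w → e ∧ ((wt L s ≡ᵇ x) ∧ (w ≡ᵇ y))) (condEv≡ a b S) (Yi≡wt-blockSum S) ⟩
    (does (c ≟ᵇ a) ∧ does (cOut n α j S ≟ᵇ b)) ∧ weights c
      ≡⟨ cong (λ d → (does (c ≟ᵇ a) ∧ does (d ≟ᵇ b)) ∧ weights c) (cOut≡blockCarry S) ⟩
    (does (c ≟ᵇ a) ∧ blockEvent L A c b s) ∧ weights c
      ≡⟨ ∧-assoc (does (c ≟ᵇ a)) _ _ ⟩
    does (c ≟ᵇ a) ∧ blockJoint L A c b x y s
      ≡⟨ cIn-factor (λ c′ → blockJoint L A c′ b x y s) a S ⟩
    blockJoint L A a b x y s ∧ lowEvent a (S %2^ R) ∎
    where
    open ≡-Reasoning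
    c : Bool
    c = cIn n α j S
    s : ℕ
    s = blockVal R L S
    weights : Bool → Bool
    weights c′ = (wt L s ≡ᵇ x) ∧ (wt L (blockSum L A c′ s) ≡ᵇ y)

  private
    count-factor : ∀ {P} G E → (∀ S → P S ≡ (G (blockVal R L S) ∧ E (S %2^ R))) →
                   count P (2 ^ n) ≡ 2 ^ k * tally G (2 ^ L) * tally E (2 ^ R)
    count-factor {P} G E P≡ = begin
      count P (2 ^ n)                                                     ≡⟨ count≡tally P (2 ^ n) ⟩
      tally P (2 ^ n)                                                     ≡⟨ cong (tally P ∘ (2 ^_)) (n≡above+blockLen+blockOff n α j) ⟩
      tally P (2 ^ ((k + L) + R))                                         ≡⟨ tally-cong (2 ^ ((k + L) + R)) (λ S _ → P≡ S) ⟩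
      tally (λ S → G (blockVal R L S) ∧ E (S %2^ R)) (2 ^ ((k + L) + R)) ≡⟨ tally-block G E k L R ⟩
      2 ^ k * tally G (2 ^ L) * tally E (2 ^ R)                           ∎
      where open ≡-Reasoning

  pmf≡blockPmf : ∀ a b x y → condPos n α j a b → pmf n α j a b x y ≡ blockPmf L A a b x y
  pmf≡blockPmf a b x y pos = trans (cong₂ frac joint event)
    (frac-*-cancel-outer (2 ^ k) _ _ (tally (lowEvent a) (2 ^ R)) (subst (0 <_) event pos))
    where
    event : count (condEv n α j a b) (2 ^ n) ≡ 2 ^ k * tally (blockEvent L A a b) (2 ^ L) * tally (lowEvent a) (2 ^ R)
    event = count-factor (blockEvent L A a b) (lowEvent a) (condEv-factor a b)
    joint : count (λ S → condEv n α j a b S ∧ ((Xi n α j S ≡ᵇ x) ∧ (Yi n α j S ≡ᵇ y))) (2 ^ n)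
            ≡ 2 ^ k * tally (blockJoint L A a b x y) (2 ^ L) * tally (lowEvent a) (2 ^ R)
    joint = count-factor (blockJoint L A a b x y) (lowEvent a) (jointEv-factor a b x y)

-- A block of ones
module _ (L : ℕ) where

  private
    N m : ℕ
    N = 2 ^ L
    m = 2 ^ L ∸ 1
    instance _ = m^n≢0 2 L

    1≤N : 1 ≤ N
    1≤N = m^n>0 2 L

    N≡1+m : N ≡ suc m
    N≡1+m = trans (sym (m∸n+n≡m 1≤N)) (+-comm m 1)

    s+m+1≡s+N : ∀ s → s + m + 1 ≡ s + N
    s+m+1≡s+N s = trans (+-assoc s m 1) (cong (s +_) (m∸n+n≡m 1≤N))

    wraps : ∀ s → s < N → (N ≤ᵇ s + N) ≡ true × (s + N) % N ≡ s
    wraps s s<N = dec-true (N ≤? s + N) (m≤n+m N s) , trans ([m+n]%n≡m%n s N) (m<n⇒m%n≡m s<N)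

  ones-carryIn : ∀ s → s < N → blockCarry L m true s ≡ true × blockSum L m true s ≡ s
  ones-carryIn s s<N rewrite s+m+1≡s+N s = wraps s s<N

  ones-noCarryIn-zero : blockCarry L m false 0 ≡ false × blockSum L m false 0 ≡ m
  ones-noCarryIn-zero rewrite +-identityʳ m =
    dec-false (N ≤? m) (<⇒≱ m<N) , m<n⇒m%n≡m m<N
    where
    m<N : m < N
    m<N = subst (m <_) (sym N≡1+m) (n<1+n m)

  ones-noCarryIn-suc : ∀ s → suc s < N → blockCarry L m false (suc s) ≡ true × blockSum L m false (suc s) ≡ s
  ones-noCarryIn-suc s 1+s<N rewrite +-identityʳ (suc s + m) | +-comm 1 (s + m) | s+m+1≡s+N s = wraps s (<-trans (n<1+n s) 1+s<N)

  private
    tally-peel : ∀ P → tally P N ≡ 𝟙 (P 0) + tally (P ∘ suc) m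
    tally-peel P = cong (tally P) N≡1+m

    suc-< : ∀ {s} → s < m → suc s < N
    suc-< s<m = subst (_ <_) (sym N≡1+m) (s<s s<m)

    tally-event-noCarryIn : ∀ b → tally (blockEvent L m false b) N ≡ 𝟙 (does (false ≟ᵇ b)) + tally (λ _ → does (true ≟ᵇ b)) m
    tally-event-noCarryIn b = trans (tally-peel (blockEvent L m false b)) (cong₂ _+_
      (cong (λ c → 𝟙 (does (c ≟ᵇ b))) (proj₁ ones-noCarryIn-zero))
      (tally-cong m (λ s s<m → cong (λ c → does (c ≟ᵇ b)) (proj₁ (ones-noCarryIn-suc s (suc-< s<m))))))

    tally-joint-carryIn : ∀ x y → tally (blockJoint L m true true x y) N ≡ tally (λ s → (wt L s ≡ᵇ x) ∧ (wt L s ≡ᵇ y)) N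
    tally-joint-carryIn x y = tally-cong N (λ s s<N → blockJoint-≡ L m true s (ones-carryIn s s<N))

  blockPmf-TT-≡ : ∀ x → blockPmf L m true true x x ≡ frac (L C x) N
  blockPmf-TT-≡ x = cong₂ frac (trans (tally-joint-carryIn x x) (tally-wt≡-wt≡ L x))
    (trans (tally-cong N (λ s s<N → cong (λ c → does (c ≟ᵇ true)) (proj₁ (ones-carryIn s s<N)))) (tally-true N))

  blockPmf-TT-≢ : ∀ {x y} → x ≢ y → blockPmf L m true true x y ≡ 0ℚ
  blockPmf-TT-≢ {x} {y} x≢y = trans (cong (λ g → frac g (tally (blockEvent L m true true) N))
                                          (trans (tally-joint-carryIn x y) (tally-wt≡-wt≢ L x≢y)))
                                    (frac-0 (tally (blockEvent L m true true) N))

  private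
    blockPmf-FF : ∀ x y → blockPmf L m false false x y ≡ frac (𝟙 ((0 ≡ᵇ x) ∧ (L ≡ᵇ y))) 1
    blockPmf-FF x y = cong₂ frac
      (begin
        tally (blockJoint L m false false x y) N
          ≡⟨ tally-peel (blockJoint L m false false x y) ⟩
        𝟙 (blockJoint L m false false x y 0) + tally (blockJoint L m false false x y ∘ suc) m
          ≡⟨ cong₂ _+_ (cong 𝟙 at0) (tally-cong m above0) ⟩
        𝟙 ((0 ≡ᵇ x) ∧ (L ≡ᵇ y)) + tally (λ _ → false) m
          ≡⟨ cong (𝟙 ((0 ≡ᵇ x) ∧ (L ≡ᵇ y)) +_) (tally-false m) ⟩
        𝟙 ((0 ≡ᵇ x) ∧ (L ≡ᵇ y)) + 0
          ≡⟨ +-identityʳ _ ⟩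
        𝟙 ((0 ≡ᵇ x) ∧ (L ≡ᵇ y)) ∎)
      (trans (tally-event-noCarryIn false) (cong suc (tally-false m)))
      where
      open ≡-Reasoning
      at0 : blockJoint L m false false x y 0 ≡ ((0 ≡ᵇ x) ∧ (L ≡ᵇ y))
      at0 = trans (blockJoint-≡ L m false 0 ones-noCarryIn-zero) (cong₂ (λ u v → (u ≡ᵇ x) ∧ (v ≡ᵇ y)) (wt-0 L) (wt-2^∸1 L))
      above0 : ∀ s → s < m → blockJoint L m false false x y (suc s) ≡ false
      above0 s s<m = blockJoint-≡ L m false (suc s) (ones-noCarryIn-suc s (suc-< s<m))

    blockPmf-FT : ∀ x y → blockPmf L m false true x y ≡ frac (predWeightCount L x y) m
    blockPmf-FT x y = cong₂ frac (tally-cong N pointwise) (trans (tally-event-noCarryIn true) (tally-true m))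
      where
      pointwise : ∀ s → s < N → blockJoint L m false true x y s ≡ predWeights L x y s
      pointwise zero    _     = blockJoint-≡ L m false 0 ones-noCarryIn-zero
      pointwise (suc s) 1+s<N = blockJoint-≡ L m false (suc s) (ones-noCarryIn-suc s 1+s<N)

  blockPmf-FF-0L : blockPmf L m false false 0 L ≡ 1ℚ
  blockPmf-FF-0L = trans (blockPmf-FF 0 L) (cong (λ b → frac (𝟙 b) 1) (dec-true (L ≟ L) refl))

  blockPmf-FF-other : ∀ x y → ¬ (x ≡ 0 × y ≡ L) → blockPmf L m false false x y ≡ 0ℚ
  blockPmf-FF-other zero    y h = trans (blockPmf-FF 0 y)
    (cong (λ b → frac (𝟙 b) 1) (dec-false (L ≟ y) (λ L≡y → h (refl , sym L≡y))))
  blockPmf-FF-other (suc x) y _ = blockPmf-FF (suc x) y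

  blockPmf-FT-in : ∀ x y → 1 ≤ x × x ≤ suc y × y < L →
                   blockPmf L m false true x y ≡ frac ((L ∸ suc y + (x ∸ 1)) C (x ∸ 1)) m
  blockPmf-FT-in (suc x) y (_ , s≤s x≤y , y<L) =
    trans (blockPmf-FT (suc x) y) (cong (λ c → frac c m) (predWeightCount≡C L x y x≤y y<L))

  blockPmf-FT-out : ∀ x y → ¬ (1 ≤ x × x ≤ suc y × y < L) → blockPmf L m false true x y ≡ 0ℚ
  blockPmf-FT-out x y h = trans (blockPmf-FT x y) (trans (cong (λ c → frac c m) (predWeightCount≡0 L x y h)) (frac-0 m))

lemma2 : (n α : ℕ) → 1 ≤ n → α < 2 ^ n →
    (i : Fin (numBlocks n α)) → blockBit n α i ≡ true →
    ((condPos n α i true true →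
       (x y : ℕ) →
         (x ≡ y → pmf n α i true true x y ≡ frac (blockLen n α i C x) (2 ^ blockLen n α i))
         × (x ≢ y → pmf n α i true true x y ≡ 0ℚ))
    × (condPos n α i false false →
       (x y : ℕ) →
         (x ≡ 0 × y ≡ blockLen n α i → pmf n α i false false x y ≡ 1ℚ)
         × (¬ (x ≡ 0 × y ≡ blockLen n α i) → pmf n α i false false x y ≡ 0ℚ))
    × (condPos n α i false true →
       (x y : ℕ) →
         (1 ≤ x × x ≤ suc y × y < blockLen n α i →
            pmf n α i false true x y
              ≡ frac ((blockLen n α i ∸ suc y + (x ∸ 1)) C (x ∸ 1)) (2 ^ blockLen n α i ∸ 1))
         × (¬ (1 ≤ x × x ≤ suc y × y < blockLen n α i) → pmf n α i false true x y ≡ 0ℚ)))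
lemma2 n α _ _ i ones =
    (λ pos x y → (λ { refl → via pos (blockPmf-TT-≡ L x) }) , (λ x≢y → via pos (blockPmf-TT-≢ L x≢y)))
  , (λ pos x y → (λ { (refl , refl) → via pos (blockPmf-FF-0L L) }) , (λ h → via pos (blockPmf-FF-other L x y h)))
  , (λ pos x y → (λ h → via pos (blockPmf-FT-in L x y h)) , (λ h → via pos (blockPmf-FT-out L x y h)))
  where
  L : ℕ
  L = blockLen n α i
  via : ∀ {a b x y q} → condPos n α i a b → blockPmf L (2 ^ L ∸ 1) a b x y ≡ q → pmf n α i a b x y ≡ q
  via {a} {b} {x} {y} pos eq =
    trans (pmf≡blockPmf n α i a b x y pos) (trans (cong (λ A → blockPmf L A a b x y) (blockVal-α-ones n α i ones)) eq)
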